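{- $(T^*,\sigma)$ is primitive: there exists $k\in\mathbb{N}$ such that for all $t,t'\in T^*$, $t'$ appears in $\sigma^k(t)$.
   Context: Let $p$ be an odd prime and $\mathbb{F}_p$ the field with $p$ elements. A tile is a unit equilateral triangle of the standard triangular lattice in the plane, oriented upward or downward, whose three corners are decorated with elements of $\mathbb{F}_p$. $\triangle(x,y,z)$ denotes the upward tile whose bottom-left, bottom-right and top corners carry $x,y,z$ respectively; $\triangledown(x,y,z)$ denotes the downward tile whose top-right, top-left and bottom corners carry $x,y,z$ respectively. $T$ is the set of all such decorated oriented tiles (up to translation), and $T^*=T\setminus\{\triangle(0,0,0),\triangledown(0,0,0)\}$. The substitution $\sigma$ inflates a tile by the factor $2$ and replaces it by four unit tiles: $\sigma(\triangle(x,y,z))$ consists of the bottom-left tile $\triangle(x,x+y,x+z)$, the bottom-right tile $\triangle(x+y,y,y+z)$, the top tile $\triangle(x+z,y+z,z)$ and the central tile $\triangledown(y+z,x+z,x+y)$; $\sigma(\triangledown(x,y,z))$ consists of the top-right tile $\triangledown(x,x+y,x+z)$, the top-left tile $\triangledown(x+y,y,y+z)$, the bottom tile $\triangledown(x+z,y+z,z)$ and the central tile $\triangle(y+z,x+z,x+y)$. $\sigma$ is applied to a patch by applying it to every tile (with inflation by $2$ about a fixed point). $\sigma^k(t)$, a $k$-supertile, is an equilateral triangle of side $2^k$ made of $4^k$ decorated unit tiles. A tile $t'$ appears in $\sigma^k(t)$ if one of these $4^k$ tiles equals $t'$ (same orientation and same decorations). -}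

module Defs where

open import Data.Nat using (ℕ; zero; suc; NonZero)
import Data.Nat as ℕ
open import Data.Nat.DivMod using (_%_; m%n<n)
open import Data.Fin using (Fin; toℕ; fromℕ<)
open import Data.List using (List; _∷_; []; concatMap)
open import Data.Product using (_×_; _,_)
open import Relation.Binary.PropositionalEquality using (_≡_)
open import Relation.Nullary using (¬_)

-- The field F_p, represented as Fin p with addition modulo p.
-- (Only addition is needed by the substitution.)
𝔽 : ℕ → Set
𝔽 p = Fin p

_⊕_ : {p : ℕ} .{{_ : NonZero p}} → 𝔽 p → 𝔽 p → 𝔽 p
_⊕_ {p} x y = fromℕ< (m%n<n (toℕ x ℕ.+ toℕ y) p)

data Orient : Set where
  up   : Orient   -- △(x,y,z): bottom-left, bottom-right, top
  down : Orient   -- ▽(x,y,z): top-right, top-left, bottom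

-- A decorated tile up to translation: orientation and the three corner labels,
-- in the order used by the paper's notation △(x,y,z) / ▽(x,y,z).
record Tile (p : ℕ) : Set where
  constructor tile
  field
    orient : Orient
    a b c  : 𝔽 p

△ : {p : ℕ} → 𝔽 p → 𝔽 p → 𝔽 p → Tile p
△ = tile up

▽ : {p : ℕ} → 𝔽 p → 𝔽 p → 𝔽 p → Tile p
▽ = tile down

-- The four unit tiles of σ(t) (their positions inside the inflated triangle
-- are irrelevant for the notion of "appears").
σ₁ : {p : ℕ} .{{_ : NonZero p}} → Tile p → List (Tile p)
σ₁ (tile up x y z) =
  △ x (x ⊕ y) (x ⊕ z) ∷ △ (x ⊕ y) y (y ⊕ z) ∷ △ (x ⊕ z) (y ⊕ z) z
    ∷ ▽ (y ⊕ z) (x ⊕ z) (x ⊕ y) ∷ []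
σ₁ (tile down x y z) =
  ▽ x (x ⊕ y) (x ⊕ z) ∷ ▽ (x ⊕ y) y (y ⊕ z) ∷ ▽ (x ⊕ z) (y ⊕ z) z
    ∷ △ (y ⊕ z) (x ⊕ z) (x ⊕ y) ∷ []

σ^ : {p : ℕ} .{{_ : NonZero p}} → ℕ → Tile p → List (Tile p)
σ^ zero    t = t ∷ []
σ^ (suc k) t = concatMap σ₁ (σ^ k t)

IsZeroTile : {p : ℕ} → Tile p → Set
IsZeroTile {p} (tile _ x y z) = (toℕ x ≡ 0) × (toℕ y ≡ 0) × (toℕ z ≡ 0)

InTStar : {p : ℕ} → Tile p → Set
InTStar t = ¬ IsZeroTile t

-- The four children of a tile are the images of three shears (x,y,z) ↦ (x, x+y, x+z),
-- (x+y, y, y+z), (x+z, y+z, z), which keep the orientation, and of a central map, which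
-- flips it. A shear has order p, so a tile and any of its shear images reach each other
-- within p steps. Shears carry every nonzero triple over F_p to (1,0,0): first to
-- (1,0,d) using the inverse of a nonzero label, then, p being odd, d is split into two
-- halves that are cleared in turn. The central child of △(1,0,0) is ▽(0,1,1), so
-- △(1,0,0) and ▽(1,0,0) reach each other; and △(1,0,0) is its own child, so all paths
-- can be padded to one common length.
module Submission where

open import Defs
open import Data.Nat using (ℕ; zero; suc; NonZero; _+_; _*_; _∸_; _%_; _/_; _≤_; z≤n; s≤s; _≟_)
open import Data.Nat.Base using (≢-nonZero; nonTrivial⇒n>1)
open import Data.Nat.Properties
  using (1+n≢0; n≤1+n; +-assoc; +-comm; +-identityʳ; *-comm; *-assoc; *-identityˡ; *-identityʳ; *-distribʳ-+; +-mono-≤; *-monoˡ-≤;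
         ≤-trans; m≤m+n; m∸n≤m; m∸n+n≡m; m+[n∸m]≡n)
open import Data.Nat.DivMod
  using (m%n<n; m%n≤n; m≡m%n+[m/n]*n; %-distribˡ-+; %-distribˡ-*; [m+kn]%n≡m%n; m%n%n≡m%n; m<n⇒m%n≡m)
open import Data.Nat.GeneralisedArithmetic using (fold; fold-+)
open import Data.Nat.Primality using (Prime; prime⇒nonTrivial)
open import Data.Nat.Coprimality using (prime⇒coprime; coprime-Bézout)
open import Data.Nat.GCD using (module Bézout)
open import Data.Fin using (Fin; toℕ; fromℕ<)
open import Data.Fin.Properties using (toℕ-fromℕ<; toℕ-injective; toℕ<n)
open import Data.List.Relation.Unary.Any using (here; there)
open import Data.List.Membership.Propositional using (_∈_; find; lose)
open import Data.List.Membership.Propositional.Properties using (∈-concatMap⁺; ∈-concatMap⁻)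
open import Data.Product using (Σ; ∃; _×_; _,_; proj₁; proj₂; swap)
open import Data.Empty using (⊥-elim)
open import Relation.Nullary using (¬_; yes; no)
open import Relation.Nullary.Decidable using (Dec; map′)
open import Relation.Binary.Bundles using (Setoid)
open import Relation.Binary.Structures using (IsEquivalence)
open import Data.Nat.Tactic.RingSolver using (solve-∀)
open import Relation.Binary.PropositionalEquality using (_≡_; refl; sym; trans; cong; cong₂; subst; subst₂; module ≡-Reasoning)
import Relation.Binary.Reasoning.Setoid as SetoidReasoning

module _ {a} {A : Set a} (f : A → A) (period : ℕ) .{{_ : NonZero period}}
         (periodic : ∀ x → fold x f period ≡ x) where
  open ≡-Reasoning

  fold-multiple : ∀ x k → fold x f (k * period) ≡ x
  fold-multiple x zero = refl
  fold-multiple x (suc k) = begin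
    fold x f (period + k * period)           ≡⟨ fold-+ x f period ⟩
    fold (fold x f (k * period)) f period    ≡⟨ cong (λ y → fold y f period) (fold-multiple x k) ⟩
    fold x f period                          ≡⟨ periodic x ⟩
    x                                        ∎

  fold-mod : ∀ x n → fold x f n ≡ fold x f (n % period)
  fold-mod x n = begin
    fold x f n                                            ≡⟨ cong (fold x f) (m≡m%n+[m/n]*n n period) ⟩
    fold x f (n % period + n / period * period)           ≡⟨ fold-+ x f (n % period) ⟩
    fold (fold x f (n / period * period)) f (n % period)  ≡⟨ cong (λ y → fold y f (n % period)) (fold-multiple x (n / period)) ⟩
    fold x f (n % period)                                 ∎

  fold-complement : ∀ x n → fold (fold x f n) f (period ∸ n % period) ≡ x
  fold-complement x n = begin
    fold (fold x f n) f (period ∸ r)   ≡⟨ cong (λ y → fold y f (period ∸ r)) (fold-mod x n) ⟩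
    fold (fold x f r) f (period ∸ r)   ≡⟨ sym (fold-+ x f (period ∸ r)) ⟩
    fold x f (period ∸ r + r)          ≡⟨ cong (fold x f) (m∸n+n≡m (m%n≤n n period)) ⟩
    fold x f period                    ≡⟨ periodic x ⟩
    x                                  ∎
    where r = n % period

module _ {p : ℕ} .{{_ : NonZero p}} where

  infix 4 _⇒[_]_ _⇒≤[_]_ _⇔≤[_]_

  record _⇒[_]_ (t : Tile p) (n : ℕ) (u : Tile p) : Set where
    constructor reach
    field reached : u ∈ σ^ n t
  open _⇒[_]_ public

  ⇒-refl : ∀ {t} → t ⇒[ 0 ] t
  ⇒-refl = reach (here refl)

  ⇒-step : ∀ {t u v n} → t ⇒[ n ] u → v ∈ σ₁ u → t ⇒[ suc n ] v
  ⇒-step (reach u∈) v∈ = reach (∈-concatMap⁺ σ₁ (lose u∈ v∈))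

  ⇒-trans : ∀ {t u v m n} → t ⇒[ m ] u → u ⇒[ n ] v → t ⇒[ n + m ] v
  ⇒-trans {n = zero} t⇒u (reach (here refl)) = t⇒u
  ⇒-trans {u = u} {n = suc n} t⇒u (reach v∈) with find (∈-concatMap⁻ σ₁ {xs = σ^ n u} v∈)
  ... | w , w∈ , v∈σ₁w = ⇒-step (⇒-trans t⇒u (reach w∈)) v∈σ₁w

  fold-⇒ : (f : Tile p → Tile p) → (∀ t → f t ∈ σ₁ t) → ∀ t n → t ⇒[ n ] fold t f n
  fold-⇒ f child t zero    = ⇒-refl
  fold-⇒ f child t (suc n) = ⇒-step (fold-⇒ f child t n) (child _)

  record _⇒≤[_]_ (t : Tile p) (B : ℕ) (u : Tile p) : Set where
    constructor within
    field
      {steps} : ℕ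
      steps≤  : steps ≤ B
      path    : t ⇒[ steps ] u

  ⇒≤-trans : ∀ {t u v A B} → t ⇒≤[ A ] u → u ⇒≤[ B ] v → t ⇒≤[ A + B ] v
  ⇒≤-trans {A = A} {B} (within {m} m≤A t⇒u) (within {n} n≤B u⇒v) =
    within (subst (_≤ A + B) (+-comm m n) (+-mono-≤ m≤A n≤B)) (⇒-trans t⇒u u⇒v)

  ⇒≤-weaken : ∀ {t u A B} → A ≤ B → t ⇒≤[ A ] u → t ⇒≤[ B ] u
  ⇒≤-weaken A≤B (within n≤A t⇒u) = within (≤-trans n≤A A≤B) t⇒u

  ⇒≤-pad-after : ∀ {t e B} → (∀ n → e ⇒[ n ] e) → t ⇒≤[ B ] e → t ⇒[ B ] e
  ⇒≤-pad-after {t} {e} {B} loop (within {n} n≤B t⇒e) =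
    subst (t ⇒[_] e) (m∸n+n≡m n≤B) (⇒-trans t⇒e (loop (B ∸ n)))

  ⇒≤-pad-before : ∀ {e t B} → (∀ n → e ⇒[ n ] e) → e ⇒≤[ B ] t → e ⇒[ B ] t
  ⇒≤-pad-before {e} {t} {B} loop (within {n} n≤B e⇒t) =
    subst (e ⇒[_] t) (m+[n∸m]≡n n≤B) (⇒-trans (loop (B ∸ n)) e⇒t)

  _⇔≤[_]_ : Tile p → ℕ → Tile p → Set
  s ⇔≤[ B ] t = s ⇒≤[ B ] t × t ⇒≤[ B ] s

  periodic-⇔ : (f : Tile p → Tile p) → (∀ t → f t ∈ σ₁ t) →
               ∀ period .{{_ : NonZero period}} → (∀ t → fold t f period ≡ t) →
               ∀ t n → t ⇔≤[ period ] fold t f n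
  periodic-⇔ f child period periodic t n =
      within (m%n≤n n period)
        (subst (t ⇒[ n % period ]_) (sym (fold-mod f period periodic t n)) (fold-⇒ f child t (n % period)))
    , within (m∸n≤m period (n % period))
        (subst (fold t f n ⇒[ period ∸ n % period ]_) (fold-complement f period periodic t n)
          (fold-⇒ f child (fold t f n) (period ∸ n % period)))

  shearˣ shearʸ shearᶻ centre : Tile p → Tile p
  shearˣ (tile o x y z) = tile o x (x ⊕ y) (x ⊕ z)
  shearʸ (tile o x y z) = tile o (x ⊕ y) y (y ⊕ z)
  shearᶻ (tile o x y z) = tile o (x ⊕ z) (y ⊕ z) z
  centre (tile up   x y z) = ▽ (y ⊕ z) (x ⊕ z) (x ⊕ y)
  centre (tile down x y z) = △ (y ⊕ z) (x ⊕ z) (x ⊕ y)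

  shearˣ∈σ₁ : ∀ t → shearˣ t ∈ σ₁ t
  shearˣ∈σ₁ (tile up   x y z) = here refl
  shearˣ∈σ₁ (tile down x y z) = here refl

  shearʸ∈σ₁ : ∀ t → shearʸ t ∈ σ₁ t
  shearʸ∈σ₁ (tile up   x y z) = there (here refl)
  shearʸ∈σ₁ (tile down x y z) = there (here refl)

  shearᶻ∈σ₁ : ∀ t → shearᶻ t ∈ σ₁ t
  shearᶻ∈σ₁ (tile up   x y z) = there (there (here refl))
  shearᶻ∈σ₁ (tile down x y z) = there (there (here refl))

  centre∈σ₁ : ∀ t → centre t ∈ σ₁ t
  centre∈σ₁ (tile up   x y z) = there (there (there (here refl)))
  centre∈σ₁ (tile down x y z) = there (there (there (here refl)))

-- Labels are handled as natural numbers modulo P = suc q; q * x then plays the role of -x.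
module Labels (q : ℕ) where

  P : ℕ
  P = suc q

  infix 4 _≋_
  record _≋_ (a b : ℕ) : Set where
    constructor mod-≡
    field %-≡ : a % P ≡ b % P

  ≋-isEquivalence : IsEquivalence _≋_
  ≋-isEquivalence = record
    { refl  = mod-≡ refl
    ; sym   = λ (mod-≡ e) → mod-≡ (sym e)
    ; trans = λ (mod-≡ e) (mod-≡ e′) → mod-≡ (trans e e′)
    }

  ≋-setoid : Setoid _ _
  ≋-setoid = record { isEquivalence = ≋-isEquivalence }

  open IsEquivalence ≋-isEquivalence public using () renaming (refl to ≋-refl; sym to ≋-sym; trans to ≋-trans)
  module ≋-Reasoning = SetoidReasoning ≋-setoid

  _≋?_ : ∀ a b → Dec (a ≋ b)
  a ≋? b = map′ mod-≡ _≋_.%-≡ (a % P ≟ b % P)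

  +-cong : ∀ {a a′ b b′} → a ≋ a′ → b ≋ b′ → a + b ≋ a′ + b′
  +-cong {a} {a′} {b} {b′} (mod-≡ e) (mod-≡ e′) = mod-≡ (begin
    (a + b) % P                ≡⟨ %-distribˡ-+ a b P ⟩
    (a % P + b % P) % P        ≡⟨ cong₂ (λ x y → (x + y) % P) e e′ ⟩
    (a′ % P + b′ % P) % P      ≡⟨ sym (%-distribˡ-+ a′ b′ P) ⟩
    (a′ + b′) % P              ∎)
    where open ≡-Reasoning

  *-cong : ∀ {a a′ b b′} → a ≋ a′ → b ≋ b′ → a * b ≋ a′ * b′
  *-cong {a} {a′} {b} {b′} (mod-≡ e) (mod-≡ e′) = mod-≡ (begin
    (a * b) % P                ≡⟨ %-distribˡ-* a b P ⟩
    (a % P * (b % P)) % P      ≡⟨ cong₂ (λ x y → (x * y) % P) e e′ ⟩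
    (a′ % P * (b′ % P)) % P    ≡⟨ sym (%-distribˡ-* a′ b′ P) ⟩
    (a′ * b′) % P              ∎)
    where open ≡-Reasoning

  ≡⇒≋ : ∀ {a b} → a ≡ b → a ≋ b
  ≡⇒≋ refl = ≋-refl

  %-≋ : ∀ a → a % P ≋ a
  %-≋ a = mod-≡ (m%n%n≡m%n a P)

  a+k*P≋a : ∀ a k → a + k * P ≋ a
  a+k*P≋a a k = mod-≡ ([m+kn]%n≡m%n a k P)

  k*P≋0 : ∀ k → k * P ≋ 0
  k*P≋0 = a+k*P≋a 0

  P*k+a≋a : ∀ k a → P * k + a ≋ a
  P*k+a≋a k a = ≋-trans (≡⇒≋ (trans (+-comm (P * k) a) (cong (a +_) (*-comm P k)))) (a+k*P≋a a k)

  q*x+x≋0 : ∀ x → q * x + x ≋ 0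
  q*x+x≋0 x = ≋-trans (≡⇒≋ (trans (+-comm (q * x) x) (*-comm P x))) (k*P≋0 x)

  q*x+[x+y]≋y : ∀ x y → q * x + (x + y) ≋ y
  q*x+[x+y]≋y x y = ≋-trans (≡⇒≋ (sym (+-assoc (q * x) x y))) (+-cong (q*x+x≋0 x) (≋-refl {y}))

  [q*x+1]+x≋1 : ∀ x → (q * x + 1) + x ≋ 1
  [q*x+1]+x≋1 x = begin
    (q * x + 1) + x    ≡⟨ +-assoc (q * x) 1 x ⟩
    q * x + (1 + x)    ≡⟨ cong (q * x +_) (+-comm 1 x) ⟩
    q * x + (x + 1)    ≈⟨ q*x+[x+y]≋y x 1 ⟩
    1                  ∎
    where open ≋-Reasoning

  1*x+a≋x : ∀ {a} x → a ≋ 0 → 1 * x + a ≋ x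
  1*x+a≋x {a} x a≋0 = begin
    1 * x + a    ≈⟨ +-cong (≋-refl {1 * x}) a≋0 ⟩
    1 * x + 0    ≡⟨ +-identityʳ (1 * x) ⟩
    1 * x        ≡⟨ *-identityˡ x ⟩
    x            ∎
    where open ≋-Reasoning

  label : ℕ → Fin P
  label n = fromℕ< (m%n<n n P)

  toℕ-label : ∀ n → toℕ (label n) ≡ n % P
  toℕ-label n = toℕ-fromℕ< (m%n<n n P)

  label-cong : ∀ {a b} → a ≋ b → label a ≡ label b
  label-cong {a} {b} (mod-≡ e) = toℕ-injective (trans (toℕ-label a) (trans e (sym (toℕ-label b))))

  label-toℕ : ∀ x → label (toℕ x) ≡ x
  label-toℕ x = toℕ-injective (trans (toℕ-label (toℕ x)) (m<n⇒m%n≡m (toℕ<n x)))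

  toℕ-≋0 : ∀ (x : Fin P) → toℕ x ≋ 0 → toℕ x ≡ 0
  toℕ-≋0 x (mod-≡ e) = trans (sym (m<n⇒m%n≡m (toℕ<n x))) e

  label-⊕ : ∀ a b → label a ⊕ label b ≡ label (a + b)
  label-⊕ a b = toℕ-injective (begin
    toℕ (label a ⊕ label b)                       ≡⟨ toℕ-fromℕ< _ ⟩
    (toℕ (label a) + toℕ (label b)) % P           ≡⟨ cong₂ (λ x y → (x + y) % P) (toℕ-label a) (toℕ-label b) ⟩
    (a % P + b % P) % P                           ≡⟨ sym (%-distribˡ-+ a b P) ⟩
    (a + b) % P                                   ≡⟨ sym (toℕ-label (a + b)) ⟩
    toℕ (label (a + b))                           ∎)
    where open ≡-Reasoning

  label-⊕′ : ∀ a b → label a ⊕ label b ≡ label (b + a)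
  label-⊕′ a b = trans (label-⊕ a b) (cong label (+-comm a b))

  T : Orient → ℕ → ℕ → ℕ → Tile P
  T o a b c = tile o (label a) (label b) (label c)

  T-cong : ∀ {o a b c a′ b′ c′} → a ≋ a′ → b ≋ b′ → c ≋ c′ → T o a b c ≡ T o a′ b′ c′
  T-cong a≋ b≋ c≋ rewrite label-cong a≋ | label-cong b≋ | label-cong c≋ = refl

  tile≡T : ∀ o x y z → tile o x y z ≡ T o (toℕ x) (toℕ y) (toℕ z)
  tile≡T o x y z rewrite label-toℕ x | label-toℕ y | label-toℕ z = refl

  flip : Orient → Orient
  flip up   = down
  flip down = up

  shearˣ-T : ∀ o a b c → shearˣ (T o a b c) ≡ T o a (a + b) (a + c)
  shearˣ-T o a b c = cong₂ (tile o (label a)) (label-⊕ a b) (label-⊕ a c)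

  shearʸ-T : ∀ o a b c → shearʸ (T o a b c) ≡ T o (b + a) b (b + c)
  shearʸ-T o a b c = cong₂ (λ x z → tile o x (label b) z) (label-⊕′ a b) (label-⊕ b c)

  shearᶻ-T : ∀ o a b c → shearᶻ (T o a b c) ≡ T o (c + a) (c + b) c
  shearᶻ-T o a b c = cong₂ (λ x y → tile o x y (label c)) (label-⊕′ a c) (label-⊕′ b c)

  centre-T : ∀ o a b c → centre (T o a b c) ≡ T (flip o) (b + c) (a + c) (a + b)
  centre-T up   a b c rewrite label-⊕ b c | label-⊕ a c | label-⊕ a b = refl
  centre-T down a b c rewrite label-⊕ b c | label-⊕ a c | label-⊕ a b = refl

  fold-shearˣ : ∀ o a b c n → fold (T o a b c) shearˣ n ≡ T o a (n * a + b) (n * a + c)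
  fold-shearˣ o a b c zero    = refl
  fold-shearˣ o a b c (suc n) = trans (cong shearˣ (fold-shearˣ o a b c n))
    (trans (shearˣ-T o a (n * a + b) (n * a + c))
           (cong₂ (T o a) (sym (+-assoc a (n * a) b)) (sym (+-assoc a (n * a) c))))

  fold-shearʸ : ∀ o a b c n → fold (T o a b c) shearʸ n ≡ T o (n * b + a) b (n * b + c)
  fold-shearʸ o a b c zero    = refl
  fold-shearʸ o a b c (suc n) = trans (cong shearʸ (fold-shearʸ o a b c n))
    (trans (shearʸ-T o (n * b + a) b (n * b + c))
           (cong₂ (λ x z → T o x b z) (sym (+-assoc b (n * b) a)) (sym (+-assoc b (n * b) c))))

  fold-shearᶻ : ∀ o a b c n → fold (T o a b c) shearᶻ n ≡ T o (n * c + a) (n * c + b) c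
  fold-shearᶻ o a b c zero    = refl
  fold-shearᶻ o a b c (suc n) = trans (cong shearᶻ (fold-shearᶻ o a b c n))
    (trans (shearᶻ-T o (n * c + a) (n * c + b) c)
           (cong₂ (λ x y → T o x y c) (sym (+-assoc c (n * c) a)) (sym (+-assoc c (n * c) b))))

  periodic-on-labels : (f : Tile P → Tile P) → (∀ o a b c → fold (T o a b c) f P ≡ T o a b c) →
                       ∀ t → fold t f P ≡ t
  periodic-on-labels f periodic (tile o x y z) =
    subst (λ t → fold t f P ≡ t) (sym (tile≡T o x y z)) (periodic o (toℕ x) (toℕ y) (toℕ z))

  shearˣ-periodic : ∀ t → fold t shearˣ P ≡ t
  shearˣ-periodic = periodic-on-labels shearˣ λ o a b c →
    trans (fold-shearˣ o a b c P) (T-cong (≋-refl {a}) (P*k+a≋a a b) (P*k+a≋a a c))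

  shearʸ-periodic : ∀ t → fold t shearʸ P ≡ t
  shearʸ-periodic = periodic-on-labels shearʸ λ o a b c →
    trans (fold-shearʸ o a b c P) (T-cong (P*k+a≋a b a) (≋-refl {b}) (P*k+a≋a b c))

  shearᶻ-periodic : ∀ t → fold t shearᶻ P ≡ t
  shearᶻ-periodic = periodic-on-labels shearᶻ λ o a b c →
    trans (fold-shearᶻ o a b c P) (T-cong (P*k+a≋a c a) (P*k+a≋a c b) (≋-refl {c}))

  Label : Set
  Label = Orient × ℕ × ℕ × ℕ

  ⟦_⟧ : Label → Tile P
  ⟦ o , a , b , c ⟧ = T o a b c

  infix 4 _⇒⟨_⟩_ _⇔⟨_⟩_

  -- k counts moves, each of which takes at most P steps. Indexing by labels rather
  -- than by tiles keeps the labels inferable, since T is not injective on ℕ.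
  record _⇒⟨_⟩_ (s : Label) (k : ℕ) (t : Label) : Set where
    constructor moves
    field reach≤ : ⟦ s ⟧ ⇒≤[ k * P ] ⟦ t ⟧
  open _⇒⟨_⟩_ public

  _⇔⟨_⟩_ : Label → ℕ → Label → Set
  s ⇔⟨ k ⟩ t = s ⇒⟨ k ⟩ t × t ⇒⟨ k ⟩ s

  ⇒⟨⟩-trans : ∀ {s t u j k} → s ⇒⟨ j ⟩ t → t ⇒⟨ k ⟩ u → s ⇒⟨ j + k ⟩ u
  ⇒⟨⟩-trans {s} {u = u} {j} {k} (moves s⇒t) (moves t⇒u) =
    moves (subst (⟦ s ⟧ ⇒≤[_] ⟦ u ⟧) (sym (*-distribʳ-+ P j k)) (⇒≤-trans s⇒t t⇒u))

  infixr 5 _⟫_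
  _⟫_ : ∀ {s t u j k} → s ⇔⟨ j ⟩ t → t ⇔⟨ k ⟩ u → s ⇔⟨ j + k ⟩ u
  _⟫_ {s} {t} {u} {j} {k} (s⇒t , t⇒s) (t⇒u , u⇒t) =
    ⇒⟨⟩-trans s⇒t t⇒u , subst (u ⇒⟨_⟩ s) (+-comm k j) (⇒⟨⟩-trans u⇒t t⇒s)

  ⇒⟨⟩-weaken : ∀ {s t j k} → j ≤ k → s ⇒⟨ j ⟩ t → s ⇒⟨ k ⟩ t
  ⇒⟨⟩-weaken j≤k (moves s⇒t) = moves (⇒≤-weaken (*-monoˡ-≤ P j≤k) s⇒t)

  ⇔⟨⟩-weaken : ∀ {s t j k} → j ≤ k → s ⇔⟨ j ⟩ t → s ⇔⟨ k ⟩ t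
  ⇔⟨⟩-weaken j≤k (s⇒t , t⇒s) = ⇒⟨⟩-weaken j≤k s⇒t , ⇒⟨⟩-weaken j≤k t⇒s

  shear-⇔ : (f : Tile P → Tile P) → (∀ t → f t ∈ σ₁ t) → (∀ t → fold t f P ≡ t) →
            ∀ {s t} n → fold ⟦ s ⟧ f n ≡ ⟦ t ⟧ → s ⇔⟨ 1 ⟩ t
  shear-⇔ f child periodic {s} {t} n fold≡ =
    let s⇒t , t⇒s = periodic-⇔ f child P periodic ⟦ s ⟧ n
        P≡1*P = sym (*-identityˡ P)
    in moves (subst₂ (⟦ s ⟧ ⇒≤[_]_) P≡1*P fold≡ s⇒t) , moves (subst₂ (_⇒≤[_] ⟦ s ⟧) fold≡ P≡1*P t⇒s)

  shearˣ-⇔ : ∀ {o a b c b′ c′} n → n * a + b ≋ b′ → n * a + c ≋ c′ → (o , a , b , c) ⇔⟨ 1 ⟩ (o , a , b′ , c′)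
  shearˣ-⇔ {o} {a} {b} {c} n b≋ c≋ =
    shear-⇔ shearˣ shearˣ∈σ₁ shearˣ-periodic n (trans (fold-shearˣ o a b c n) (T-cong (≋-refl {a}) b≋ c≋))

  shearʸ-⇔ : ∀ {o a b c a′ c′} n → n * b + a ≋ a′ → n * b + c ≋ c′ → (o , a , b , c) ⇔⟨ 1 ⟩ (o , a′ , b , c′)
  shearʸ-⇔ {o} {a} {b} {c} n a≋ c≋ =
    shear-⇔ shearʸ shearʸ∈σ₁ shearʸ-periodic n (trans (fold-shearʸ o a b c n) (T-cong a≋ (≋-refl {b}) c≋))

  shearᶻ-⇔ : ∀ {o a b c a′ b′} n → n * c + a ≋ a′ → n * c + b ≋ b′ → (o , a , b , c) ⇔⟨ 1 ⟩ (o , a′ , b′ , c)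
  shearᶻ-⇔ {o} {a} {b} {c} n a≋ b≋ =
    shear-⇔ shearᶻ shearᶻ∈σ₁ shearᶻ-periodic n (trans (fold-shearᶻ o a b c n) (T-cong a≋ b≋ (≋-refl {c})))

  centre-⇒ : ∀ o → (o , 1 , 0 , 0) ⇒⟨ 1 ⟩ (flip o , 0 , 1 , 1)
  centre-⇒ o = moves (within (s≤s z≤n) (subst (T o 1 0 0 ⇒[ 1 ]_) (centre-T o 1 0 0) (⇒-step ⇒-refl (centre∈σ₁ _))))

  half : ℕ
  half = suc (P / 2)

  half+half≋1 : P % 2 ≡ 1 → half + half ≋ 1
  half+half≋1 odd = begin
    half + half            ≡⟨ halves (P / 2) ⟩
    1 + (1 + P / 2 * 2)    ≡⟨ cong (1 +_) (sym P≡1+[P/2]*2) ⟩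
    1 + P                  ≡⟨ cong (1 +_) (sym (+-identityʳ P)) ⟩
    1 + 1 * P              ≈⟨ a+k*P≋a 1 1 ⟩
    1                      ∎
    where
      open ≋-Reasoning
      halves : ∀ h → suc h + suc h ≡ 1 + (1 + h * 2)
      halves = solve-∀
      P≡1+[P/2]*2 : P ≡ 1 + P / 2 * 2
      P≡1+[P/2]*2 = trans (m≡m%n+[m/n]*n P 2) (cong (_+ P / 2 * 2) odd)

  prime⇒1≄0 : Prime P → ¬ 1 ≋ 0
  prime⇒1≄0 P-prime (mod-≡ 1%P≡0) =
    1+n≢0 (trans (sym (m<n⇒m%n≡m (nonTrivial⇒n>1 P {{prime⇒nonTrivial P-prime}}))) 1%P≡0)

  prime⇒inverse : Prime P → ∀ {a} → ¬ a ≋ 0 → ∃ λ u → u * a ≋ 1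
  prime⇒inverse P-prime {a} a≄0
    with coprime-Bézout (prime⇒coprime P-prime {{≢-nonZero (λ a%P≡0 → a≄0 (mod-≡ a%P≡0))}} (m%n<n a P))
  ... | Bézout.-+ x y eq = y , (begin
    y * a            ≈⟨ *-cong (≋-refl {y}) (≋-sym (%-≋ a)) ⟩
    y * (a % P)      ≡⟨ sym eq ⟩
    1 + x * P        ≈⟨ a+k*P≋a 1 x ⟩
    1                ∎)
    where open ≋-Reasoning
  ... | Bézout.+- x y eq = q * y , (begin
    q * y * a        ≡⟨ *-assoc q y a ⟩
    q * (y * a)      ≈⟨ *-cong (≋-refl {q}) (*-cong (≋-refl {y}) (≋-sym (%-≋ a))) ⟩
    q * w            ≡⟨ sym (+-identityʳ (q * w)) ⟩
    q * w + 0        ≈⟨ +-cong (≋-refl {q * w}) (≋-sym w+1≋0) ⟩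
    q * w + (w + 1)  ≈⟨ q*x+[x+y]≋y w 1 ⟩
    1                ∎)
    where
      open ≋-Reasoning
      w = y * (a % P)
      w+1≋0 : w + 1 ≋ 0
      w+1≋0 = ≋-trans (≡⇒≋ (trans (+-comm w 1) eq)) (k*P≋0 x)

  module Homing (h : ℕ) (h+h≋1 : h + h ≋ 1)
                (inverse : ∀ {a} → ¬ a ≋ 0 → ∃ λ u → u * a ≋ 1)
                (1≄0 : ¬ 1 ≋ 0) where
    open ≋-Reasoning

    home : Orient → Label
    home o = o , 1 , 0 , 0

    -- Halving d lets the second shear turn (1 + h d, h d, d) into (1, h d, h d).
    clear-last : ∀ o d → (o , 1 , 0 , d) ⇔⟨ 3 ⟩ home o
    clear-last o d =
         shearᶻ-⇔ h ≋-refl (≡⇒≋ (+-identityʳ hd))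
      ⟫ shearʸ-⇔ q (q*x+[x+y]≋y hd 1) d≋
      ⟫ shearˣ-⇔ (q * hd) hd≋0 hd≋0
      where
        hd = h * d
        d≋ : q * hd + d ≋ hd
        d≋ = begin
          q * hd + d              ≡⟨ cong (q * hd +_) (sym (*-identityˡ d)) ⟩
          q * hd + 1 * d          ≈⟨ +-cong (≋-refl {q * hd}) (*-cong (≋-sym h+h≋1) (≋-refl {d})) ⟩
          q * hd + (h + h) * d    ≡⟨ cong (q * hd +_) (*-distribʳ-+ d h h) ⟩
          q * hd + (hd + hd)      ≈⟨ q*x+[x+y]≋y hd hd ⟩
          hd                      ∎
        hd≋0 : q * hd * 1 + hd ≋ 0
        hd≋0 = ≋-trans (≡⇒≋ (cong (_+ hd) (*-identityʳ (q * hd)))) (q*x+x≋0 hd)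

    unit-to-home : ∀ {o a b c} → ¬ a ≋ 0 → (o , a , b , c) ⇔⟨ 6 ⟩ home o
    unit-to-home {o} {a} {b} {c} a≄0 =
         shearˣ-⇔ n b≋1 ≋-refl
      ⟫ shearʸ-⇔ (q * a + 1) (≋-trans (≡⇒≋ (cong (_+ a) (*-identityʳ (q * a + 1)))) ([q*x+1]+x≋1 a)) ≋-refl
      ⟫ shearˣ-⇔ q (q*x+x≋0 1) ≋-refl
      ⟫ clear-last o _
      where
        u = proj₁ (inverse a≄0)
        n = (q * b + 1) * u
        b≋1 : n * a + b ≋ 1
        b≋1 = begin
          n * a + b                    ≡⟨ cong (_+ b) (*-assoc (q * b + 1) u a) ⟩
          (q * b + 1) * (u * a) + b    ≈⟨ +-cong (*-cong (≋-refl {q * b + 1}) (proj₂ (inverse a≄0))) (≋-refl {b}) ⟩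
          (q * b + 1) * 1 + b          ≡⟨ cong (_+ b) (*-identityʳ (q * b + 1)) ⟩
          (q * b + 1) + b              ≈⟨ [q*x+1]+x≋1 b ⟩
          1                            ∎

    hub : ∀ o a b c → ¬ (a ≋ 0 × b ≋ 0 × c ≋ 0) → (o , a , b , c) ⇔⟨ 7 ⟩ home o
    hub o a b c nonzero with a ≋? 0 | b ≋? 0 | c ≋? 0
    ... | no a≄0  | _       | _       = ⇔⟨⟩-weaken (n≤1+n 6) (unit-to-home a≄0)
    ... | yes a≋0 | no b≄0  | _       =
      shearʸ-⇔ 1 ≋-refl ≋-refl ⟫ unit-to-home (λ 1*b+a≋0 → b≄0 (≋-trans (≋-sym (1*x+a≋x b a≋0)) 1*b+a≋0))
    ... | yes a≋0 | yes _   | no c≄0  =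
      shearᶻ-⇔ 1 ≋-refl ≋-refl ⟫ unit-to-home (λ 1*c+a≋0 → c≄0 (≋-trans (≋-sym (1*x+a≋x c a≋0)) 1*c+a≋0))
    ... | yes a≋0 | yes b≋0 | yes c≋0 = ⊥-elim (nonzero (a≋0 , b≋0 , c≋0))

    flip-home : home up ⇔⟨ 8 ⟩ home down
    flip-home = ⇒⟨⟩-trans (centre-⇒ up) (proj₁ (hub down 0 1 1 0,1,1≄0))
              , ⇒⟨⟩-trans (centre-⇒ down) (proj₁ (hub up 0 1 1 0,1,1≄0))
      where
        0,1,1≄0 : ¬ (0 ≋ 0 × 1 ≋ 0 × 1 ≋ 0)
        0,1,1≄0 (_ , 1≋0 , _) = 1≄0 1≋0

    labels : Tile P → Label
    labels (tile o x y z) = o , toℕ x , toℕ y , toℕ z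

    ⟦labels⟧ : ∀ t → ⟦ labels t ⟧ ≡ t
    ⟦labels⟧ (tile o x y z) = sym (tile≡T o x y z)

    labels≄0 : ∀ {x y z : Fin P} → ¬ (toℕ x ≡ 0 × toℕ y ≡ 0 × toℕ z ≡ 0) → ¬ (toℕ x ≋ 0 × toℕ y ≋ 0 × toℕ z ≋ 0)
    labels≄0 {x = x} {y} {z} nonzero (x≋0 , y≋0 , z≋0) = nonzero (toℕ-≋0 x x≋0 , toℕ-≋0 y y≋0 , toℕ-≋0 z z≋0)

    toward-home : ∀ t → InTStar t → labels t ⇔⟨ 15 ⟩ home up
    toward-home (tile up   x y z) nonzero = ⇔⟨⟩-weaken (m≤m+n 7 8) (hub up _ _ _ (labels≄0 nonzero))
    toward-home (tile down x y z) nonzero = hub down _ _ _ (labels≄0 nonzero) ⟫ swap flip-home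

    home-loop : ∀ n → ⟦ home up ⟧ ⇒[ n ] ⟦ home up ⟧
    home-loop zero    = ⇒-refl
    home-loop (suc n) = subst (⟦ home up ⟧ ⇒[ suc n ]_) (shearʸ-T up 1 0 0) (⇒-step (home-loop n) (shearʸ∈σ₁ _))

    σ-primitive : Σ ℕ (λ k → (t t′ : Tile P) → InTStar t → InTStar t′ → t′ ∈ σ^ k t)
    σ-primitive = B + B , λ t t′ t≄0 t′≄0 → reached (⇒-trans (to-home t t≄0) (from-home t′ t′≄0))
      where
        B = 15 * P
        to-home : ∀ t → InTStar t → t ⇒[ B ] ⟦ home up ⟧
        to-home t t≄0 = ⇒≤-pad-after home-loop
          (subst (_⇒≤[ B ] ⟦ home up ⟧) (⟦labels⟧ t) (reach≤ (proj₁ (toward-home t t≄0))))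
        from-home : ∀ t → InTStar t → ⟦ home up ⟧ ⇒[ B ] t
        from-home t t≄0 = ⇒≤-pad-before home-loop
          (subst (⟦ home up ⟧ ⇒≤[ B ]_) (⟦labels⟧ t) (reach≤ (proj₂ (toward-home t t≄0))))

mainTheorem2 : (p : ℕ) → Prime p → p % 2 ≡ 1 → .{{_ : NonZero p}} →
    Σ ℕ (λ k → (t t′ : Tile p) → InTStar t → InTStar t′ → t′ ∈ σ^ k t)
mainTheorem2 zero    _       ()
mainTheorem2 (suc q) p-prime odd =
  Homing.σ-primitive half (half+half≋1 odd) (prime⇒inverse p-prime) (prime⇒1≄0 p-prime)
  where open Labels q
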